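{- Let $x,y$ be Lucas strings of length $n$ with $y=x+\delta_i$ and $x_i=1$. Then for every $j\in[1,n]$, if $x+\delta_j$ is a Lucas string then $y+\delta_j$ is a Lucas string.
   Context: A Lucas string of length $n$ is a binary string $b_1\ldots b_n$ with no two consecutive 1's and with $b_1b_n\neq 1$. For a binary string $x=x_1\ldots x_n$ and $i\in[1,n]$, $x+\delta_i$ denotes the string obtained from $x$ by complementing its $i$-th coordinate. -}

module Defs where

open import Data.Bool using (Bool; true; false; not; _∧_)
open import Data.Nat using (ℕ; zero; suc)
open import Data.Fin using (Fin; inject₁; fromℕ) renaming (zero to fzero; suc to fsuc)
open import Data.Vec using (Vec; lookup; updateAt; head; last)
open import Relation.Binary.PropositionalEquality using (_≡_)

-- Binary strings of length n: Vec Bool n (true = 1); positions 1..n are Fin n (0-based).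

NoConsecutiveOnes : ∀ {n} → Vec Bool n → Set
NoConsecutiveOnes {zero} b = Data.Unit.⊤ where import Data.Unit
NoConsecutiveOnes {suc n} b =
  (k : Fin n) → (lookup b (inject₁ k) ∧ lookup b (fsuc k)) ≡ false

EndsCondition : ∀ {n} → Vec Bool n → Set
EndsCondition {zero} b = Data.Unit.⊤ where import Data.Unit
EndsCondition {suc n} b = (lookup b fzero ∧ lookup b (fromℕ n)) ≡ false

IsLucas : ∀ {n} → Vec Bool n → Set
IsLucas b = NoConsecutiveOnes b Data.Product.× EndsCondition b
  where import Data.Product

-- x + δ_i : complement the i-th coordinate.
flip : ∀ {n} → Vec Bool n → Fin n → Vec Bool n
flip x i = updateAt x i not

{-# OPTIONS --safe #-}
-- Being a Lucas string is a downward-closed property of bit vectors ordered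
-- pointwise by false ≤ true. For j = i, flipping y at i gives back x. For j ≠ i,
-- flips commute, so y + δ_j = (x + δ_j) + δ_i; since x + δ_j still has a 1 at i,
-- this turns a 1 into a 0 and lies below the Lucas string x + δ_j.
module Submission where

open import Defs
open import Data.Nat using (ℕ; zero; suc)
open import Data.Fin using (Fin; _≟_)
open import Data.Bool using (Bool; true; false; not; _∧_; _≤_; b≤b; f≤t)
open import Data.Bool.Properties using (≤-reflexive; ≤-minimum; ≤-antisym; not-involutive)
open import Data.Vec using (Vec; lookup)
open import Data.Vec.Properties
  using (lookup∘updateAt; lookup∘updateAt′; updateAt-updateAt; updateAt-id-local; updateAt-commutes)
open import Data.Vec.Relation.Binary.Pointwise.Extensional using (Pointwise; ext)
open import Data.Product using (_,_)
open import Relation.Nullary using (yes; no)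
open import Relation.Binary.PropositionalEquality using (_≡_; _≢_; refl; sym; trans; subst)

∧-mono-≤ : ∀ {a b c d} → a ≤ b → c ≤ d → a ∧ c ≤ b ∧ d
∧-mono-≤ {d = d} f≤t _ = ≤-minimum d
∧-mono-≤ {false} b≤b _ = b≤b
∧-mono-≤ {true} b≤b c≤d = c≤d

∧≡false-antitone : ∀ {a b c d} → a ≤ b → c ≤ d → b ∧ d ≡ false → a ∧ c ≡ false
∧≡false-antitone a≤b c≤d bd≡false =
  ≤-antisym (subst (_ ≤_) bd≡false (∧-mono-≤ a≤b c≤d)) (≤-minimum _)

isLucas-antitone : ∀ {n} {a b : Vec Bool n} → Pointwise _≤_ a b → IsLucas b → IsLucas a
isLucas-antitone {zero} _ lucas = lucas
isLucas-antitone {suc n} (ext a≤b) (noOnes , ends) =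
  (λ k → ∧≡false-antitone (a≤b _) (a≤b _) (noOnes k)) , ∧≡false-antitone (a≤b _) (a≤b _) ends

flip-involutive : ∀ {n} (x : Vec Bool n) i → flip (flip x i) i ≡ x
flip-involutive x i = trans (updateAt-updateAt i x) (updateAt-id-local i x (not-involutive _))

flip-commutes : ∀ {n} (x : Vec Bool n) {i j} → i ≢ j → flip (flip x i) j ≡ flip (flip x j) i
flip-commutes x {i} {j} i≢j = updateAt-commutes j i (λ j≡i → i≢j (sym j≡i)) x

flip-one-≤ : ∀ {n} (z : Vec Bool n) i → lookup z i ≡ true → Pointwise _≤_ (flip z i) z
flip-one-≤ z i zᵢ≡true = ext pointwise
  where
  pointwise : ∀ k → lookup (flip z i) k ≤ lookup z k
  pointwise k with k ≟ i
  ... | yes refl rewrite lookup∘updateAt k {not} z | zᵢ≡true = f≤t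
  ... | no k≢i = ≤-reflexive (lookup∘updateAt′ k i k≢i z)

mainTheorem9 : (n : ℕ) (x y : Vec Bool n) (i : Fin n) →
    IsLucas x → IsLucas y → y ≡ flip x i → lookup x i ≡ true →
    (j : Fin n) → IsLucas (flip x j) → IsLucas (flip y j)
mainTheorem9 n x y i lucasX _ refl xᵢ≡true j lucasXj with i ≟ j
... | yes refl = subst IsLucas (sym (flip-involutive x i)) lucasX
... | no i≢j = subst IsLucas (sym (flip-commutes x i≢j))
  (isLucas-antitone (flip-one-≤ (flip x j) i xjᵢ≡true) lucasXj)
  where
  xjᵢ≡true : lookup (flip x j) i ≡ true
  xjᵢ≡true = trans (lookup∘updateAt′ i j i≢j x) xᵢ≡true
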